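{- Let $\{a,b,c,d,e\}$ be a Diophantine quintuple with $a<b<c<d<e$ such that $\{a,b,c\}$ is an Euler triple, i.e. $c=a+b+2r$ where $r=\sqrt{ab+1}$, and $d=4r(a+r)(b+r)$. Let $s,t,x,y,z,X,Y,Z,W$ be the positive integers with $ac+1=s^2$, $bc+1=t^2$, $ad+1=x^2$, $bd+1=y^2$, $cd+1=z^2$, $ae+1=X^2$, $be+1=Y^2$, $ce+1=Z^2$, $de+1=W^2$. Suppose $\varepsilon\in\{1,-1\}$ and nonnegative integers $j,k,l,m,n$ satisfy $Z\sqrt a+X\sqrt c=(\sqrt a+\sqrt c)(s+\sqrt{ac})^{2j}$, $Z\sqrt b+Y\sqrt c=(\sqrt b+\sqrt c)(t+\sqrt{bc})^{2k}$, $W\sqrt a+X\sqrt d=(\varepsilon\sqrt a+\sqrt d)(x+\sqrt{ad})^{2l}$, $W\sqrt b+Y\sqrt d=(\varepsilon\sqrt b+\sqrt d)(y+\sqrt{bd})^{2m}$ and $W\sqrt c+Z\sqrt d=(\varepsilon\sqrt c+\sqrt d)(z+\sqrt{cd})^{2n}$. Then at least one of the following holds: (I) $l\equiv n\equiv 0\pmod s$; (II) $m\equiv n\equiv 0\pmod t$; (III) $n\equiv -\varepsilon r\pmod{st}$.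
   Context: A Diophantine $m$-tuple is a set of $m$ distinct positive integers such that the product of any two of them increased by $1$ is a perfect square. An Euler triple is a Diophantine triple of the form $\{a,b,a+b+2\sqrt{ab+1}\}$. -}

module Defs where

open import Data.Nat using (ℕ) renaming (_+_ to _+ℕ_; _*_ to _*ℕ_)
open import Data.Integer using (ℤ; +_; _+_; _*_; -_; 1ℤ; 0ℤ)
open import Data.Product using (_×_; _,_; ∃)
open import Data.Fin using (Fin)
open import Relation.Binary.PropositionalEquality using (_≡_; _≢_)

IsDiophantineTuple : (m : ℕ) → (Fin m → ℕ) → Set
IsDiophantineTuple m v =
  ((i : Fin m) → v i ≢ 0)
  × ((i j : Fin m) → i ≢ j → v i ≢ v j)
  × ((i j : Fin m) → i ≢ j → ∃ λ k → v i *ℕ v j +ℕ 1 ≡ k *ℕ k)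

-- powSqrt u D k = (p , q)  encodes  (u + √D)^k = p + q √D.
powSqrt : ℤ → ℤ → ℕ → ℤ × ℤ
powSqrt u D ℕ.zero = (1ℤ , 0ℤ)
powSqrt u D (ℕ.suc k) with powSqrt u D k
... | (p , q) = (p * u + q * D , p + q * u)

-- SqrtEq α β A B ε u k  encodes the real identity
--   A √α + B √β = (ε √α + √β) (u + √(αβ))^k .
-- Writing (u + √(αβ))^k = p + q √(αβ), the right-hand side equals
--   (ε p + q β) √α + (p + ε q α) √β ,
-- and (since αβ is not a perfect square for the pairs used) √α and √β are
-- linearly independent over ℚ, so the identity is coefficientwise.
SqrtEq : ℤ → ℤ → ℤ → ℤ → ℤ → ℤ → ℕ → Set
SqrtEq α β A B ε u k with powSqrt u (α * β) k
... | (p , q) = (A ≡ ε * p + q * β) × (B ≡ p + ε * q * α)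

{-# OPTIONS --safe #-}
module Submission where

-- Write (s + √(ac))^(2j) = p + q √(ac). Since (s + √(ac))² = 2s² − 1 + 2s √(ac), modulo 2s we
-- have p ≡ ±1 and q ≡ 0, hence X ≡ Z ≡ p. Because s divides d, modulo 2s also
-- (x + √(ad))^(2l) ≡ 1 + 2lx √(ad) and (z + √(cd))^(2n) ≡ 1 + 2nz √(cd), so that
-- X ≡ 1 + 2εl·xa and Z ≡ 1 + 2εn·zc. For the Euler quadruple s = a + r, t = b + r,
-- x = 2at + 1 and z = 2st + 1, which makes xa·t ≡ 1 and zc·r ≡ 1 (mod s): either
-- l ≡ n ≡ 0 or n ≡ −εr (mod s). The same holds modulo t, and as rt − bs = 1 the two
-- congruences n ≡ −εr combine into one modulo st.

open import Defs
open import Data.Nat using (ℕ; zero; suc; _<_) renaming (_+_ to _+ℕ_; _*_ to _*ℕ_)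
open import Data.Nat.Divisibility renaming (_∣_ to _∣ℕ_) using (divides)
import Data.Nat.Properties as ℕ
import Data.Nat.Tactic.RingSolver as ℕ-Solver
open import Data.Integer using (ℤ; +_; _+_; _*_; -_; _-_; 1ℤ; 0ℤ)
open import Data.Integer.Divisibility using (_∣_)
open import Data.Integer.Divisibility.Signed as Signed
  using (∣ᵤ⇒∣; ∣⇒∣ᵤ; ∣m⇒∣-m; ∣m∣n⇒∣m+n; ∣m⇒∣m*n; ∣n⇒∣m*n; *-monoʳ-∣; *-cancelˡ-∣)
  renaming (_∣_ to _∣ₛ_)
open import Data.Integer.Properties using (pos-+; pos-*; +-identityʳ; *-identityˡ; *-zeroʳ; neg-involutive)
import Data.Integer.Tactic.RingSolver as ℤ-Solver
open import Data.Product using (_×_; _,_; proj₁; proj₂)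
open import Data.Sum using (_⊎_; inj₁; inj₂)
open import Level using (0ℓ)
open import Relation.Binary.Bundles using (Setoid)
open import Relation.Binary.Definitions using (tri<; tri≈; tri>)
open import Relation.Binary.PropositionalEquality
  using (_≡_; refl; sym; trans; cong; cong₂; subst; module ≡-Reasoning)
open import Relation.Nullary using (contradiction)

module Congruence where

  open import Data.List using (_∷_; [])

  infixl 1 _by_

  _by_ : ∀ {k a b} → k ∣ₛ a → a ≡ b → k ∣ₛ b
  k∣a by refl = k∣a

  infix 4 _≡_mod_

  -- A record rather than a synonym for m ∣ x - y, so that x, y and m are inferable.
  record _≡_mod_ (x y m : ℤ) : Set where
    constructor congruent
    field divides-difference : m ∣ₛ x - y

  module _ {m : ℤ} where

    mod-refl : ∀ {x} → x ≡ x mod m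
    mod-refl {x} = congruent (Signed.divides 0ℤ (ℤ-Solver.solve (x ∷ m ∷ [])))

    mod-reflexive : ∀ {x y} → x ≡ y → x ≡ y mod m
    mod-reflexive refl = mod-refl

    mod-sym : ∀ {x y} → x ≡ y mod m → y ≡ x mod m
    mod-sym {x} {y} (congruent p) = congruent (∣m⇒∣-m p by ℤ-Solver.solve (x ∷ y ∷ []))

    mod-trans : ∀ {x y z} → x ≡ y mod m → y ≡ z mod m → x ≡ z mod m
    mod-trans {x} {y} {z} (congruent p) (congruent q) =
      congruent (∣m∣n⇒∣m+n p q by ℤ-Solver.solve (x ∷ y ∷ z ∷ []))

    +-cong-mod : ∀ {x y u v} → x ≡ y mod m → u ≡ v mod m → x + u ≡ y + v mod m
    +-cong-mod {x} {y} {u} {v} (congruent p) (congruent q) =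
      congruent (∣m∣n⇒∣m+n p q by ℤ-Solver.solve (x ∷ y ∷ u ∷ v ∷ []))

    *-cong-mod : ∀ {x y u v} → x ≡ y mod m → u ≡ v mod m → x * u ≡ y * v mod m
    *-cong-mod {x} {y} {u} {v} (congruent p) (congruent q) =
      congruent (∣m∣n⇒∣m+n (∣m⇒∣m*n u p) (∣n⇒∣m*n y q) by ℤ-Solver.solve (x ∷ y ∷ u ∷ v ∷ []))

    -‿cong-mod : ∀ {x y} → x ≡ y mod m → - x ≡ - y mod m
    -‿cong-mod {x} {y} (congruent p) = congruent (∣m⇒∣-m p by ℤ-Solver.solve (x ∷ y ∷ []))

    +-congˡ-mod : ∀ x {u v} → u ≡ v mod m → x + u ≡ x + v mod m
    +-congˡ-mod x = +-cong-mod (mod-refl {x})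

    +-congʳ-mod : ∀ x {u v} → u ≡ v mod m → u + x ≡ v + x mod m
    +-congʳ-mod x u≡v = +-cong-mod u≡v (mod-refl {x})

    *-congˡ-mod : ∀ x {u v} → u ≡ v mod m → x * u ≡ x * v mod m
    *-congˡ-mod x = *-cong-mod (mod-refl {x})

    *-congʳ-mod : ∀ x {u v} → u ≡ v mod m → u * x ≡ v * x mod m
    *-congʳ-mod x u≡v = *-cong-mod u≡v (mod-refl {x})

    +-multiple-mod : ∀ {a} x y → a ≡ 0ℤ mod m → x + y * a ≡ x mod m
    +-multiple-mod {a} x y (congruent p) =
      congruent (∣n⇒∣m*n y p by ℤ-Solver.solve (a ∷ x ∷ y ∷ []))

    ∣ₛ⇒≡0-mod : ∀ {x} → m ∣ₛ x → x ≡ 0ℤ mod m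
    ∣ₛ⇒≡0-mod {x} m∣x = congruent (m∣x by sym (+-identityʳ x))

    ≡0-mod⇒∣ : ∀ {x} → x ≡ 0ℤ mod m → m ∣ x
    ≡0-mod⇒∣ {x} (congruent p) = ∣⇒∣ᵤ (p by +-identityʳ x)

    ≡-neg-mod⇒∣ : ∀ {x y} → x ≡ - y mod m → m ∣ x + y
    ≡-neg-mod⇒∣ {x} {y} (congruent p) = ∣⇒∣ᵤ (p by cong (λ w → x + w) (neg-involutive y))

  mod-self : ∀ {m} → m ≡ 0ℤ mod m
  mod-self {m} = congruent (Signed.divides 1ℤ (ℤ-Solver.solve (m ∷ [])))

  *-cong-modulus : ∀ {x y m} k → x ≡ y mod m → k * x ≡ k * y mod (k * m)
  *-cong-modulus {x} {y} {m} k (congruent p) =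
    congruent (k*m∣k*[x-y] by ℤ-Solver.solve (k ∷ x ∷ y ∷ []))
    where
    k*m∣k*[x-y] : k * m ∣ₛ k * (x - y)
    k*m∣k*[x-y] = *-monoʳ-∣ k p

  halve-odd-mod : ∀ {x y m} → 1ℤ + + 2 * x ≡ 1ℤ + + 2 * y mod (+ 2 * m) → x ≡ y mod m
  halve-odd-mod {x} {y} (congruent p) =
    congruent (*-cancelˡ-∣ (+ 2) (p by ℤ-Solver.solve (x ∷ y ∷ [])))

  bezout-mod : ∀ {S T x y} u v → v * S + 1ℤ ≡ u * T →
               x ≡ y mod S → x ≡ y mod T → x ≡ y mod (S * T)
  bezout-mod {S} {T} {x} {y} u v bez
             (congruent (Signed.divides q₁ e₁)) (congruent (Signed.divides q₂ e₂)) =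
    congruent (Signed.divides (q₁ * u - q₂ * v) (begin
      x - y
        ≡⟨ ℤ-Solver.solve (x ∷ y ∷ v ∷ S ∷ []) ⟩
      (x - y) * (v * S + 1ℤ) - (x - y) * (v * S)
        ≡⟨ cong (λ w → (x - y) * w - (x - y) * (v * S)) bez ⟩
      (x - y) * (u * T) - (x - y) * (v * S)
        ≡⟨ cong₂ (λ w₁ w₂ → w₁ * (u * T) - w₂ * (v * S)) e₁ e₂ ⟩
      q₁ * S * (u * T) - q₂ * T * (v * S)
        ≡⟨ ℤ-Solver.solve (q₁ ∷ q₂ ∷ u ∷ v ∷ S ∷ T ∷ []) ⟩
      (q₁ * u - q₂ * v) * (S * T)
        ∎))
    where open ≡-Reasoning

  mod-setoid : ℤ → Setoid 0ℓ 0ℓ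
  mod-setoid m = record
    { Carrier       = ℤ
    ; _≈_           = λ x y → x ≡ y mod m
    ; isEquivalence = record { refl = mod-refl ; sym = mod-sym ; trans = mod-trans }
    }

  module ≡-mod-Reasoning (m : ℤ) where
    open import Relation.Binary.Reasoning.Setoid (mod-setoid m) public

  cancel-unit-mod : ∀ {m c} ε n u v → ε * ε ≡ 1ℤ → u * v ≡ 1ℤ mod m → ε * n * u ≡ c mod m →
                n ≡ ε * c * v mod m
  cancel-unit-mod {m} {c} ε n u v ε²≡1 uv≡1 εnu≡c = begin
    n                      ≡⟨ ℤ-Solver.solve (n ∷ []) ⟩
    1ℤ * n * 1ℤ            ≈⟨ *-congˡ-mod (1ℤ * n) uv≡1 ⟨
    1ℤ * n * (u * v)       ≡⟨ cong (λ w → w * n * (u * v)) ε²≡1 ⟨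
    ε * ε * n * (u * v)    ≡⟨ ℤ-Solver.solve (ε ∷ n ∷ u ∷ v ∷ []) ⟩
    ε * n * u * (ε * v)    ≈⟨ *-congʳ-mod (ε * v) εnu≡c ⟩
    c * (ε * v)            ≡⟨ ℤ-Solver.solve (c ∷ ε ∷ v ∷ []) ⟩
    ε * c * v              ∎
    where open ≡-mod-Reasoning m

open Congruence

module PellPowers where

  ratPart : ℤ → ℤ → ℕ → ℤ
  ratPart u D k = proj₁ (powSqrt u D k)

  surdPart : ℤ → ℤ → ℕ → ℤ
  surdPart u D k = proj₂ (powSqrt u D k)

  -- (u + √D)² = (2u² − 1) + 2u √D ≡ −1 (mod 2u) when D = u² − 1. The left-hand sides of
  -- the identities below are two unfolded steps of powSqrt.
  powSqrt-+2-mod-2u : ∀ {u D} → D ≡ u * u - 1ℤ → ∀ k →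
    ratPart u D (2 +ℕ k) ≡ - ratPart u D k mod (+ 2 * u) ×
    surdPart u D (2 +ℕ k) ≡ - surdPart u D k mod (+ 2 * u)
  powSqrt-+2-mod-2u {u} refl k =
    congruent (Signed.divides (u * p + (u * u - 1ℤ) * q) (rat-identity u p q)) ,
    congruent (Signed.divides (p + u * q) (surd-identity u p q))
    where
    p = ratPart u (u * u - 1ℤ) k
    q = surdPart u (u * u - 1ℤ) k
    rat-identity : ∀ u p q →
      (p * u + q * (u * u - 1ℤ)) * u + (p + q * u) * (u * u - 1ℤ) - - p
        ≡ (u * p + (u * u - 1ℤ) * q) * (+ 2 * u)
    rat-identity = ℤ-Solver.solve-∀
    surd-identity : ∀ u p q →
      (p * u + q * (u * u - 1ℤ)) + (p + q * u) * u - - q ≡ (p + u * q) * (+ 2 * u)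
    surd-identity = ℤ-Solver.solve-∀

  powSqrt-even-mod-2u : ∀ {u D} → D ≡ u * u - 1ℤ → ∀ j →
    (ratPart u D (2 *ℕ j) ≡ 1ℤ mod (+ 2 * u) ⊎ ratPart u D (2 *ℕ j) ≡ - 1ℤ mod (+ 2 * u)) ×
    surdPart u D (2 *ℕ j) ≡ 0ℤ mod (+ 2 * u)
  powSqrt-even-mod-2u D≡ zero = inj₁ mod-refl , mod-refl
  -- 2 *ℕ suc j reduces to suc (j +ℕ suc (j +ℕ 0)).
  powSqrt-even-mod-2u {u} D≡ (suc j) rewrite ℕ.+-suc j (j +ℕ 0)
    with powSqrt-+2-mod-2u {u} D≡ (2 *ℕ j) | powSqrt-even-mod-2u {u} D≡ j
  ... | p′≡-p , q′≡-q | inj₁ p≡1 , q≡0 =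
    inj₂ (mod-trans p′≡-p (-‿cong-mod p≡1)) , mod-trans q′≡-q (-‿cong-mod q≡0)
  ... | p′≡-p , q′≡-q | inj₂ p≡-1 , q≡0 =
    inj₁ (mod-trans p′≡-p (-‿cong-mod p≡-1)) , mod-trans q′≡-q (-‿cong-mod q≡0)

  -- (x + √D)² = (1 + 2D) + 2x √D ≡ 1 + 2x √D modulo any divisor of 2D, when D = x² − 1.
  powSqrt-+2-mod : ∀ {m x D} → D ≡ x * x - 1ℤ → + 2 * D ≡ 0ℤ mod m → ∀ k →
    ratPart x D (2 +ℕ k) ≡ ratPart x D k mod m ×
    surdPart x D (2 +ℕ k) ≡ surdPart x D k + + 2 * x * ratPart x D k mod m
  powSqrt-+2-mod {x = x} refl 2D≡0 k =
    mod-trans (mod-reflexive (rat-identity x p q)) (+-multiple-mod p (p + x * q) 2D≡0) ,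
    mod-trans (mod-reflexive (surd-identity x p q)) (+-multiple-mod (q + + 2 * x * p) q 2D≡0)
    where
    p = ratPart x (x * x - 1ℤ) k
    q = surdPart x (x * x - 1ℤ) k
    rat-identity : ∀ x p q →
      (p * x + q * (x * x - 1ℤ)) * x + (p + q * x) * (x * x - 1ℤ)
        ≡ p + (p + x * q) * (+ 2 * (x * x - 1ℤ))
    rat-identity = ℤ-Solver.solve-∀
    surd-identity : ∀ x p q →
      (p * x + q * (x * x - 1ℤ)) + (p + q * x) * x
        ≡ (q + + 2 * x * p) + q * (+ 2 * (x * x - 1ℤ))
    surd-identity = ℤ-Solver.solve-∀

  powSqrt-even-mod : ∀ {m x D} → D ≡ x * x - 1ℤ → + 2 * D ≡ 0ℤ mod m → ∀ l →
    ratPart x D (2 *ℕ l) ≡ 1ℤ mod m × surdPart x D (2 *ℕ l) ≡ + l * (+ 2 * x) mod m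
  powSqrt-even-mod D≡ 2D≡0 zero = mod-refl , mod-refl
  powSqrt-even-mod {m} {x} D≡ 2D≡0 (suc l) rewrite ℕ.+-suc l (l +ℕ 0)
    with powSqrt-+2-mod {m} {x} D≡ 2D≡0 (2 *ℕ l) | powSqrt-even-mod {m} {x} D≡ 2D≡0 l
  ... | p′≡p , q′≡q+2xp | p≡1 , q≡2lx =
    mod-trans p′≡p p≡1 ,
    mod-trans q′≡q+2xp (mod-trans (+-cong-mod q≡2lx (*-congˡ-mod (+ 2 * x) p≡1))
                                  (mod-reflexive (count-up (+ l) (+ 2 * x))))
    where
    count-up : ∀ L y → L * y + y * 1ℤ ≡ (1ℤ + L) * y
    count-up = ℤ-Solver.solve-∀

  powSqrt-even-coefficient : ∀ {m x D α B ε} l → D ≡ x * x - 1ℤ → + 2 * D ≡ 0ℤ mod m →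
    B ≡ ratPart x D (2 *ℕ l) + ε * surdPart x D (2 *ℕ l) * α →
    B ≡ 1ℤ + + 2 * (ε * + l * (x * α)) mod m
  powSqrt-even-coefficient {x = x} {α = α} {ε = ε} l D≡ 2D≡0 refl =
    mod-trans (+-cong-mod (proj₁ pell) (*-congʳ-mod α (*-congˡ-mod ε (proj₂ pell))))
              (mod-reflexive (rearrange ε (+ l) x α))
    where
    pell = powSqrt-even-mod {x = x} D≡ 2D≡0 l
    rearrange : ∀ ε L x α → 1ℤ + ε * (L * (+ 2 * x)) * α ≡ 1ℤ + + 2 * (ε * L * (x * α))
    rearrange = ℤ-Solver.solve-∀

open PellPowers

module PellDichotomy where

  open import Data.List using (_∷_; [])

  +1≡⇒≡-1 : ∀ {x y} → x + 1ℤ ≡ y → x ≡ y - 1ℤ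
  +1≡⇒≡-1 {x} refl = ℤ-Solver.solve (x ∷ [])

  pell-dichotomy : ∀ {A C D S U V W X Z x z ε : ℤ} (j l n : ℕ) → ε * ε ≡ 1ℤ →
    A * C + 1ℤ ≡ S * S → A * D + 1ℤ ≡ x * x → C * D + 1ℤ ≡ z * z → D ≡ 0ℤ mod S →
    x * A * V ≡ 1ℤ mod S → z * C * U ≡ 1ℤ mod S →
    SqrtEq A C Z X 1ℤ S (2 *ℕ j) → SqrtEq A D W X ε x (2 *ℕ l) → SqrtEq C D W Z ε z (2 *ℕ n) →
    (+ l ≡ 0ℤ mod S × + n ≡ 0ℤ mod S) ⊎ + n ≡ - (ε * U) mod S
  pell-dichotomy {A} {C} {D} {S} {U} {V} {W} {X} {Z} {x} {z} {ε} j l n ε²≡1 ac+1 ad+1 cd+1 D≡0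
                 xAV≡1 zCU≡1 (Z≡ , X≡) (_ , X≡′) (_ , Z≡′) = by-sign (proj₁ pell)
    where
    2S = + 2 * S
    pell = powSqrt-even-mod-2u {S} {A * C} (+1≡⇒≡-1 ac+1) j
    p = ratPart S (A * C) (2 *ℕ j)
    q = surdPart S (A * C) (2 *ℕ j)
    q≡0 = proj₂ pell

    X≡p : X ≡ p mod 2S
    X≡p = begin
      X                  ≡⟨ X≡ ⟩
      p + 1ℤ * q * A     ≈⟨ +-congˡ-mod p (*-congʳ-mod A (*-congˡ-mod 1ℤ q≡0)) ⟩
      p + 0ℤ             ≡⟨ +-identityʳ p ⟩
      p                  ∎
      where open ≡-mod-Reasoning 2S
    Z≡p : Z ≡ p mod 2S
    Z≡p = begin
      Z                  ≡⟨ Z≡ ⟩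
      1ℤ * p + q * C     ≈⟨ +-congˡ-mod (1ℤ * p) (*-congʳ-mod C q≡0) ⟩
      1ℤ * p + 0ℤ        ≡⟨ +-identityʳ (1ℤ * p) ⟩
      1ℤ * p             ≡⟨ *-identityˡ p ⟩
      p                  ∎
      where open ≡-mod-Reasoning 2S

    2YD≡0 : ∀ Y → + 2 * (Y * D) ≡ 0ℤ mod 2S
    2YD≡0 Y = *-cong-modulus (+ 2) (mod-trans (*-congˡ-mod Y D≡0) (mod-reflexive (*-zeroʳ Y)))
    X≡odd : X ≡ 1ℤ + + 2 * (ε * + l * (x * A)) mod 2S
    X≡odd = powSqrt-even-coefficient {x = x} {α = A} {ε = ε} l (+1≡⇒≡-1 ad+1) (2YD≡0 A) X≡′
    Z≡odd : Z ≡ 1ℤ + + 2 * (ε * + n * (z * C)) mod 2S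
    Z≡odd = powSqrt-even-coefficient {x = z} {α = C} {ε = ε} n (+1≡⇒≡-1 cd+1) (2YD≡0 C) Z≡′

    l-coefficient : ∀ σ → p ≡ 1ℤ + + 2 * σ mod 2S → + l ≡ ε * σ * V mod S
    l-coefficient σ p≡ = cancel-unit-mod ε (+ l) (x * A) V ε²≡1 xAV≡1
      (halve-odd-mod {ε * + l * (x * A)} {σ} (mod-trans (mod-sym X≡odd) (mod-trans X≡p p≡)))
    n-coefficient : ∀ σ → p ≡ 1ℤ + + 2 * σ mod 2S → + n ≡ ε * σ * U mod S
    n-coefficient σ p≡ = cancel-unit-mod ε (+ n) (z * C) U ε²≡1 zCU≡1
      (halve-odd-mod {ε * + n * (z * C)} {σ} (mod-trans (mod-sym Z≡odd) (mod-trans Z≡p p≡)))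

    by-sign : p ≡ 1ℤ mod 2S ⊎ p ≡ - 1ℤ mod 2S →
              (+ l ≡ 0ℤ mod S × + n ≡ 0ℤ mod S) ⊎ + n ≡ - (ε * U) mod S
    by-sign (inj₁ p≡1)  =
      inj₁ (mod-trans (l-coefficient 0ℤ p≡1) (mod-reflexive (cong (_* V) (*-zeroʳ ε))) ,
            mod-trans (n-coefficient 0ℤ p≡1) (mod-reflexive (cong (_* U) (*-zeroʳ ε))))
    by-sign (inj₂ p≡-1) = inj₂ (mod-trans (n-coefficient (- 1ℤ) p≡-1) (mod-reflexive ε[-1]U≡-εU))
      where
      ε[-1]U≡-εU : ε * - 1ℤ * U ≡ - (ε * U)
      ε[-1]U≡-εU = ℤ-Solver.solve (ε ∷ U ∷ [])

open PellDichotomy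

module EulerQuadruple where

  open import Data.List using (_∷_; [])

  *-self-injective : ∀ u v → u *ℕ u ≡ v *ℕ v → u ≡ v
  *-self-injective u v u²≡v² with ℕ.<-cmp u v
  ... | tri< u<v _ _ = contradiction u²≡v² (ℕ.<⇒≢ (ℕ.*-mono-< u<v u<v))
  ... | tri≈ _ u≡v _ = u≡v
  ... | tri> _ _ v<u = contradiction (sym u²≡v²) (ℕ.<⇒≢ (ℕ.*-mono-< v<u v<u))

  consecutive-square : ∀ u {v} → u +ℕ 1 ≡ v → 4 *ℕ u *ℕ v +ℕ 1 ≡ (2 *ℕ u +ℕ 1) *ℕ (2 *ℕ u +ℕ 1)
  consecutive-square u refl = ℕ-Solver.solve (u ∷ [])

  module _ (a b r : ℕ) (ab+1≡r² : a *ℕ b +ℕ 1 ≡ r *ℕ r) where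
    open ≡-Reasoning

    euler-at+1≡rs : a *ℕ (b +ℕ r) +ℕ 1 ≡ r *ℕ (a +ℕ r)
    euler-at+1≡rs = begin
      a *ℕ (b +ℕ r) +ℕ 1      ≡⟨ ℕ-Solver.solve (a ∷ b ∷ r ∷ []) ⟩
      (a *ℕ b +ℕ 1) +ℕ a *ℕ r  ≡⟨ cong (_+ℕ a *ℕ r) ab+1≡r² ⟩
      r *ℕ r +ℕ a *ℕ r         ≡⟨ ℕ-Solver.solve (a ∷ r ∷ []) ⟩
      r *ℕ (a +ℕ r)            ∎

    euler-st+1≡rc : (a +ℕ r) *ℕ (b +ℕ r) +ℕ 1 ≡ r *ℕ (a +ℕ b +ℕ 2 *ℕ r)
    euler-st+1≡rc = begin
      (a +ℕ r) *ℕ (b +ℕ r) +ℕ 1           ≡⟨ ℕ-Solver.solve (a ∷ b ∷ r ∷ []) ⟩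
      (a *ℕ b +ℕ 1) +ℕ r *ℕ (a +ℕ b +ℕ r)  ≡⟨ cong (_+ℕ r *ℕ (a +ℕ b +ℕ r)) ab+1≡r² ⟩
      r *ℕ r +ℕ r *ℕ (a +ℕ b +ℕ r)         ≡⟨ ℕ-Solver.solve (a ∷ b ∷ r ∷ []) ⟩
      r *ℕ (a +ℕ b +ℕ 2 *ℕ r)              ∎

    euler-ac+1≡s² : a *ℕ (a +ℕ b +ℕ 2 *ℕ r) +ℕ 1 ≡ (a +ℕ r) *ℕ (a +ℕ r)
    euler-ac+1≡s² = begin
      a *ℕ (a +ℕ b +ℕ 2 *ℕ r) +ℕ 1          ≡⟨ ℕ-Solver.solve (a ∷ b ∷ r ∷ []) ⟩
      (a *ℕ b +ℕ 1) +ℕ a *ℕ (a +ℕ 2 *ℕ r)   ≡⟨ cong (_+ℕ a *ℕ (a +ℕ 2 *ℕ r)) ab+1≡r² ⟩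
      r *ℕ r +ℕ a *ℕ (a +ℕ 2 *ℕ r)          ≡⟨ ℕ-Solver.solve (a ∷ r ∷ []) ⟩
      (a +ℕ r) *ℕ (a +ℕ r)                  ∎

    euler-ad+1≡x² : a *ℕ (4 *ℕ r *ℕ (a +ℕ r) *ℕ (b +ℕ r)) +ℕ 1
             ≡ (2 *ℕ (a *ℕ (b +ℕ r)) +ℕ 1) *ℕ (2 *ℕ (a *ℕ (b +ℕ r)) +ℕ 1)
    euler-ad+1≡x² = begin
      a *ℕ (4 *ℕ r *ℕ (a +ℕ r) *ℕ (b +ℕ r)) +ℕ 1      ≡⟨ ℕ-Solver.solve (a ∷ b ∷ r ∷ []) ⟩
      4 *ℕ (a *ℕ (b +ℕ r)) *ℕ (r *ℕ (a +ℕ r)) +ℕ 1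
        ≡⟨ consecutive-square (a *ℕ (b +ℕ r)) euler-at+1≡rs ⟩
      (2 *ℕ (a *ℕ (b +ℕ r)) +ℕ 1) *ℕ (2 *ℕ (a *ℕ (b +ℕ r)) +ℕ 1) ∎

    euler-cd+1≡z² : (a +ℕ b +ℕ 2 *ℕ r) *ℕ (4 *ℕ r *ℕ (a +ℕ r) *ℕ (b +ℕ r)) +ℕ 1
             ≡ (2 *ℕ ((a +ℕ r) *ℕ (b +ℕ r)) +ℕ 1) *ℕ (2 *ℕ ((a +ℕ r) *ℕ (b +ℕ r)) +ℕ 1)
    euler-cd+1≡z² = begin
      (a +ℕ b +ℕ 2 *ℕ r) *ℕ (4 *ℕ r *ℕ (a +ℕ r) *ℕ (b +ℕ r)) +ℕ 1
        ≡⟨ ℕ-Solver.solve (a ∷ b ∷ r ∷ []) ⟩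
      4 *ℕ ((a +ℕ r) *ℕ (b +ℕ r)) *ℕ (r *ℕ (a +ℕ b +ℕ 2 *ℕ r)) +ℕ 1
        ≡⟨ consecutive-square ((a +ℕ r) *ℕ (b +ℕ r)) euler-st+1≡rc ⟩
      (2 *ℕ ((a +ℕ r) *ℕ (b +ℕ r)) +ℕ 1) *ℕ (2 *ℕ ((a +ℕ r) *ℕ (b +ℕ r)) +ℕ 1) ∎

  xat≡1-mod-s : ∀ {x} a t r s → a * t + 1ℤ ≡ r * s → x ≡ + 2 * (a * t) + 1ℤ →
                x * a * t ≡ 1ℤ mod s
  xat≡1-mod-s a t r s at+1≡rs refl = begin
    (+ 2 * (a * t) + 1ℤ) * a * t      ≡⟨ ℤ-Solver.solve (a ∷ t ∷ []) ⟩
    (+ 2 * (a * t) + 1ℤ) * (a * t)    ≈⟨ *-cong-mod (+-congʳ-mod 1ℤ (*-congˡ-mod (+ 2) at≡-1)) at≡-1 ⟩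
    (+ 2 * - 1ℤ + 1ℤ) * - 1ℤ          ≡⟨⟩
    1ℤ                                ∎
    where
    open ≡-mod-Reasoning s
    at≡-1 : a * t ≡ - 1ℤ mod s
    at≡-1 = begin
      a * t                 ≡⟨ ℤ-Solver.solve (a ∷ t ∷ []) ⟩
      - 1ℤ + (a * t + 1ℤ)   ≡⟨ cong (λ w → - 1ℤ + w) at+1≡rs ⟩
      - 1ℤ + r * s          ≈⟨ +-multiple-mod (- 1ℤ) r mod-self ⟩
      - 1ℤ                  ∎

  zcr≡1-mod-s : ∀ {c z} b r s t → b * s + 1ℤ ≡ r * t → c ≡ s + t → z ≡ + 2 * (s * t) + 1ℤ →
                z * c * r ≡ 1ℤ mod s
  zcr≡1-mod-s b r s t bs+1≡rt refl refl = begin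
    (+ 2 * (s * t) + 1ℤ) * (s + t) * r                    ≡⟨ ℤ-Solver.solve (r ∷ s ∷ t ∷ []) ⟩
    r * t + r * (+ 2 * (s * t) + + 2 * (t * t) + 1ℤ) * s  ≈⟨ +-multiple-mod (r * t) k mod-self ⟩
    r * t                                                 ≡⟨ bs+1≡rt ⟨
    b * s + 1ℤ                                            ≡⟨ ℤ-Solver.solve (b ∷ s ∷ []) ⟩
    1ℤ + b * s                                            ≈⟨ +-multiple-mod 1ℤ b mod-self ⟩
    1ℤ                                                    ∎
    where
    open ≡-mod-Reasoning s
    k = r * (+ 2 * (s * t) + + 2 * (t * t) + 1ℤ)

  pos-*+1≡* : ∀ u v w y → u *ℕ v +ℕ 1 ≡ w *ℕ y → + u * + v + 1ℤ ≡ + w * + y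
  pos-*+1≡* u v w y eq = begin
    + u * + v + 1ℤ    ≡⟨ cong (_+ 1ℤ) (pos-* u v) ⟨
    + (u *ℕ v) + 1ℤ   ≡⟨ pos-+ (u *ℕ v) 1 ⟨
    + (u *ℕ v +ℕ 1)   ≡⟨ cong +_ eq ⟩
    + (w *ℕ y)        ≡⟨ pos-* w y ⟩
    + w * + y         ∎
    where open ≡-Reasoning

  pos-2*+1 : ∀ u v → + (2 *ℕ (u *ℕ v) +ℕ 1) ≡ + 2 * (+ u * + v) + 1ℤ
  pos-2*+1 u v = trans (pos-+ (2 *ℕ (u *ℕ v)) 1)
                       (cong (_+ 1ℤ) (trans (pos-* 2 (u *ℕ v)) (cong (λ w → + 2 * w) (pos-* u v))))

  record IsEulerQuadruple (a b c d r : ℕ) : Set where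
    constructor euler-quadruple
    field
      ab+1≡r²   : a *ℕ b +ℕ 1 ≡ r *ℕ r
      c≡a+b+2r  : c ≡ a +ℕ b +ℕ 2 *ℕ r
      d≡4r[a+r][b+r] : d ≡ 4 *ℕ r *ℕ (a +ℕ r) *ℕ (b +ℕ r)

  ab+1-comm : ∀ a b {k} → a *ℕ b +ℕ 1 ≡ k → b *ℕ a +ℕ 1 ≡ k
  ab+1-comm a b = trans (cong (_+ℕ 1) (ℕ.*-comm b a))

  euler-swap : ∀ {a b c d r} → IsEulerQuadruple a b c d r → IsEulerQuadruple b a c d r
  euler-swap {a} {b} {r = r} (euler-quadruple ab+1≡r² refl refl) =
    euler-quadruple (ab+1-comm a b ab+1≡r²) (cong (_+ℕ 2 *ℕ r) (ℕ.+-comm a b))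
                    (ℕ-Solver.solve (a ∷ b ∷ r ∷ []))

  euler-dichotomy : ∀ (a b c d r s x z X Z W : ℕ) (ε : ℤ) (j l n : ℕ) → ε * ε ≡ 1ℤ →
    IsEulerQuadruple a b c d r →
    a *ℕ c +ℕ 1 ≡ s *ℕ s → a *ℕ d +ℕ 1 ≡ x *ℕ x → c *ℕ d +ℕ 1 ≡ z *ℕ z →
    SqrtEq (+ a) (+ c) (+ Z) (+ X) 1ℤ (+ s) (2 *ℕ j) →
    SqrtEq (+ a) (+ d) (+ W) (+ X) ε (+ x) (2 *ℕ l) →
    SqrtEq (+ c) (+ d) (+ W) (+ Z) ε (+ z) (2 *ℕ n) →
    s ≡ a +ℕ r × ((+ l ≡ 0ℤ mod + s × + n ≡ 0ℤ mod + s) ⊎ + n ≡ - (ε * + r) mod + s)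
  euler-dichotomy a b _ _ r s x z X Z W ε j l n ε²≡1 (euler-quadruple ab+1≡r² refl refl)
                  ac+1≡s² ad+1≡x² cd+1≡z² sac sad scd
    with *-self-injective s (a +ℕ r)
           (trans (sym ac+1≡s²) (euler-ac+1≡s² a b r ab+1≡r²))
       | *-self-injective x (2 *ℕ (a *ℕ (b +ℕ r)) +ℕ 1)
           (trans (sym ad+1≡x²) (euler-ad+1≡x² a b r ab+1≡r²))
       | *-self-injective z (2 *ℕ ((a +ℕ r) *ℕ (b +ℕ r)) +ℕ 1)
           (trans (sym cd+1≡z²) (euler-cd+1≡z² a b r ab+1≡r²))
  ... | refl | refl | refl =
    refl ,
    pell-dichotomy {A = + a} {C = + c} {U = + r} {V = + t} {W = + W} {X = + X} {Z = + Z}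
                   {x = + x′} {z = + z′} {ε = ε} j l n ε²≡1
                   (pos-*+1≡* a c s′ s′ ac+1≡s²) (pos-*+1≡* a d x′ x′ ad+1≡x²)
                   (pos-*+1≡* c d z′ z′ cd+1≡z²)
                   d≡0 xat≡1 zcr≡1 sac sad scd
    where
    s′ = a +ℕ r
    t = b +ℕ r
    c = a +ℕ b +ℕ 2 *ℕ r
    d = 4 *ℕ r *ℕ s′ *ℕ t
    x′ = 2 *ℕ (a *ℕ t) +ℕ 1
    z′ = 2 *ℕ (s′ *ℕ t) +ℕ 1

    d≡4rt*s : 4 *ℕ r *ℕ (a +ℕ r) *ℕ (b +ℕ r) ≡ 4 *ℕ r *ℕ (b +ℕ r) *ℕ (a +ℕ r)
    d≡4rt*s = ℕ-Solver.solve (a ∷ b ∷ r ∷ [])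
    c≡s+t : a +ℕ b +ℕ 2 *ℕ r ≡ (a +ℕ r) +ℕ (b +ℕ r)
    c≡s+t = ℕ-Solver.solve (a ∷ b ∷ r ∷ [])

    d≡0 : + d ≡ 0ℤ mod + s′
    d≡0 = ∣ₛ⇒≡0-mod (∣ᵤ⇒∣ (divides (4 *ℕ r *ℕ t) d≡4rt*s))
    xat≡1 : + x′ * + a * + t ≡ 1ℤ mod + s′
    xat≡1 = xat≡1-mod-s (+ a) (+ t) (+ r) (+ s′)
              (pos-*+1≡* a t r s′ (euler-at+1≡rs a b r ab+1≡r²)) (pos-2*+1 a t)
    zcr≡1 : + z′ * + c * + r ≡ 1ℤ mod + s′
    zcr≡1 = zcr≡1-mod-s (+ b) (+ r) (+ s′) (+ t)
              (pos-*+1≡* b s′ r t (euler-at+1≡rs b a r (ab+1-comm a b ab+1≡r²)))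
              (cong +_ c≡s+t) (pos-2*+1 s′ t)

  combine-dichotomies : ∀ (a b r : ℕ) (ε : ℤ) {s t l m n} → a *ℕ b +ℕ 1 ≡ r *ℕ r →
    s ≡ a +ℕ r × ((+ l ≡ 0ℤ mod + s × + n ≡ 0ℤ mod + s) ⊎ + n ≡ - (ε * + r) mod + s) →
    t ≡ b +ℕ r × ((+ m ≡ 0ℤ mod + t × + n ≡ 0ℤ mod + t) ⊎ + n ≡ - (ε * + r) mod + t) →
    (s ∣ℕ l × s ∣ℕ n) ⊎ (t ∣ℕ m × t ∣ℕ n) ⊎ (+ (s *ℕ t)) ∣ (+ n + ε * + r)
  combine-dichotomies _ _ _ _ _ (_ , inj₁ (l≡0 , n≡0)) _ = inj₁ (≡0-mod⇒∣ l≡0 , ≡0-mod⇒∣ n≡0)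
  combine-dichotomies _ _ _ _ _ (_ , inj₂ _) (_ , inj₁ (m≡0 , n≡0)) =
    inj₂ (inj₁ (≡0-mod⇒∣ m≡0 , ≡0-mod⇒∣ n≡0))
  combine-dichotomies a b r ε {n = n} ab+1≡r² (refl , inj₂ n≡-εr-mod-s) (refl , inj₂ n≡-εr-mod-t) =
    inj₂ (inj₂ (≡-neg-mod⇒∣ (subst (λ k → + n ≡ - (ε * + r) mod k) (sym (pos-* (a +ℕ r) (b +ℕ r)))
                                   (bezout-mod (+ r) (+ b) bs+1≡rt n≡-εr-mod-s n≡-εr-mod-t))))
    where
    bs+1≡rt : + b * + (a +ℕ r) + 1ℤ ≡ + r * + (b +ℕ r)
    bs+1≡rt = pos-*+1≡* b (a +ℕ r) r (b +ℕ r) (euler-at+1≡rs b a r (ab+1-comm a b ab+1≡r²))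

open EulerQuadruple

open import Data.Vec.Functional using (_∷_; [])

±1²≡1 : ∀ {ε} → ε ≡ 1ℤ ⊎ ε ≡ - 1ℤ → ε * ε ≡ 1ℤ
±1²≡1 (inj₁ refl) = refl
±1²≡1 (inj₂ refl) = refl

lemma8p2 : (a b c d e r s t x y z X Y Z W : ℕ) (ε : ℤ) (j k l m n : ℕ) →
    IsDiophantineTuple 5 (a ∷ b ∷ c ∷ d ∷ e ∷ []) →
    a < b → b < c → c < d → d < e →
    a *ℕ b +ℕ 1 ≡ r *ℕ r →
    c ≡ a +ℕ b +ℕ 2 *ℕ r →
    d ≡ 4 *ℕ r *ℕ (a +ℕ r) *ℕ (b +ℕ r) →
    a *ℕ c +ℕ 1 ≡ s *ℕ s → b *ℕ c +ℕ 1 ≡ t *ℕ t →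
    a *ℕ d +ℕ 1 ≡ x *ℕ x → b *ℕ d +ℕ 1 ≡ y *ℕ y → c *ℕ d +ℕ 1 ≡ z *ℕ z →
    a *ℕ e +ℕ 1 ≡ X *ℕ X → b *ℕ e +ℕ 1 ≡ Y *ℕ Y → c *ℕ e +ℕ 1 ≡ Z *ℕ Z →
    d *ℕ e +ℕ 1 ≡ W *ℕ W →
    (ε ≡ 1ℤ ⊎ ε ≡ - 1ℤ) →
    SqrtEq (+ a) (+ c) (+ Z) (+ X) 1ℤ (+ s) (2 *ℕ j) →
    SqrtEq (+ b) (+ c) (+ Z) (+ Y) 1ℤ (+ t) (2 *ℕ k) →
    SqrtEq (+ a) (+ d) (+ W) (+ X) ε (+ x) (2 *ℕ l) →
    SqrtEq (+ b) (+ d) (+ W) (+ Y) ε (+ y) (2 *ℕ m) →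
    SqrtEq (+ c) (+ d) (+ W) (+ Z) ε (+ z) (2 *ℕ n) →
    (s ∣ℕ l × s ∣ℕ n) ⊎ (t ∣ℕ m × t ∣ℕ n) ⊎ ((+ (s *ℕ t)) ∣ (+ n + ε * + r))
lemma8p2 a b c d e r s t x y z X Y Z W ε j k l m n _ _ _ _ _ ab+1≡r² c≡ d≡
         ac+1≡s² bc+1≡t² ad+1≡x² bd+1≡y² cd+1≡z² _ _ _ _ ε≡±1 sac sbc sad sbd scd =
  combine-dichotomies a b r ε ab+1≡r²
    (euler-dichotomy a b c d r s x z X Z W ε j l n ε²≡1 euler ac+1≡s² ad+1≡x² cd+1≡z² sac sad scd)
    (euler-dichotomy b a c d r t y z Y Z W ε k m n ε²≡1 (euler-swap euler) bc+1≡t² bd+1≡y² cd+1≡z²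
                     sbc sbd scd)
  where
  euler : IsEulerQuadruple a b c d r
  euler = euler-quadruple ab+1≡r² c≡ d≡
  ε²≡1 : ε * ε ≡ 1ℤ
  ε²≡1 = ±1²≡1 ε≡±1
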